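{- For every Cartesian tree $T\in\mathcal{C}_m$ with $m\ge 2$ nodes, $m-1\le|\mathrm{ng}(T)|\le 3(m-2)+1$.
   Context: Sequences consist of pairwise distinct integers; $\tau(x,i)$ exchanges $x[i]$ and $x[i+1]$. The Cartesian tree $C(x)$ of $x[1\ldots m]$ has as root the position $g$ of the minimum of $x$, left subtree $C(x[1\ldots g-1])$ and right subtree the Cartesian tree of $x[g+1\ldots m]$. $\mathcal{C}_m$ is the set of Cartesian trees (binary trees) with $m$ nodes. For $T\in\mathcal{C}_m$ and $1\le i\le m-1$, $\mathrm{ng}(T,i)=\{C(y): \exists x,\ C(x)=T,\ y=\tau(x,i)\}$ and $\mathrm{ng}(T)=\bigcup_{i=1}^{m-1}\mathrm{ng}(T,i)$. -}

module Defs where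

open import Data.Nat using (ℕ; zero; suc; _+_; _≤_)
open import Data.Integer using (ℤ; _<_)
open import Data.List using (List; []; _∷_; _++_; [_])
open import Data.List.Relation.Unary.All using (All)
open import Data.List.Relation.Unary.Unique.Propositional using (Unique)
open import Data.Product using (Σ; _×_; ∃)

data Tree : Set where
  leaf : Tree
  node : Tree → Tree → Tree

size : Tree → ℕ
size leaf = 0
size (node l r) = suc (size l + size r)

data IsCart : List ℤ → Tree → Set where
  cart-[] : IsCart [] leaf
  cart-node : ∀ {l r : List ℤ} {a : ℤ} {Tl Tr : Tree} →
    All (a <_) l → All (a <_) r →
    IsCart l Tl → IsCart r Tr →
    IsCart (l ++ [ a ] ++ r) (node Tl Tr)

-- τ(x,i): exchange x[i] and x[i+1] (1-based positions); identity if out of range.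
tau : List ℤ → ℕ → List ℤ
tau (a ∷ b ∷ xs) (suc zero) = b ∷ a ∷ xs
tau (a ∷ xs) (suc (suc i)) = a ∷ tau xs (suc i)
tau xs _ = xs

NgAt : Tree → ℕ → Tree → Set
NgAt T i S = Σ (List ℤ) λ x → Unique x × IsCart x T × IsCart (tau x i) S

Ng : Tree → Tree → Set
Ng T S = ∃ λ i → 1 ≤ i × suc i ≤ size T × NgAt T i S

{-# OPTIONS --safe #-}

-- Write x = l ++ a ∷ r with a the minimum, so C(x) = node L R with C(l) = L and C(r) = R. A swap inside l
-- or inside r replaces L or R by one of its neighbours. Swapping a with the last entry b of l gives
-- node C(l minus b) C(b ∷ r), where C(b ∷ r) is R with a new node inserted on its left spine at one of
-- 1 + leftSpine R depths, depending on b; symmetrically for the first entry of r. Each of these trees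
-- occurs, because realizing sequences of two trees can be glued along a common entry, and the resulting
-- list has no repetitions, since its blocks differ in the left subtree. Hence
--   |ng(node L R)| = |ng L| + |ng R| + [L ≠ leaf] (1 + leftSpine R) + [R ≠ leaf] (1 + rightSpine L),
-- which gives m - 1 ≤ |ng T| and, through the invariant
--   |ng T| + [T ≠ leaf] + leftSpine T + rightSpine T ≤ 3 size T,
-- the bound |ng T| ≤ 3(m - 2) + 1.
module Submission where

open import Defs
open import Data.Nat using (ℕ; zero; suc; _+_; _*_; _∸_; _≤_; _<_; z≤n; s≤s; s≤s⁻¹; NonZero; >-nonZero)
import Data.Nat.Properties as ℕ
open import Data.Integer as ℤ using (ℤ; +_; -[1+_])
import Data.Integer.Properties as ℤ
open import Data.List using (List; []; _∷_; _++_; [_]; _∷ʳ_; length; map)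
open import Data.List.Properties
  using (map-++; length-++; length-map; ++-assoc; ∷ʳ-++; ∷-injective; ∷ʳ-injective; ++-conicalʳ)
open import Data.List.Reverse using (reverseView; []; _∶_∶ʳ_)
open import Data.List.Relation.Unary.All as All using (All; []; _∷_)
import Data.List.Relation.Unary.All.Properties as All
open import Data.List.Relation.Unary.AllPairs using ([]; _∷_)
open import Data.List.Relation.Unary.Any using (here; there)
open import Data.List.Relation.Unary.Unique.Propositional using (Unique)
import Data.List.Relation.Unary.Unique.Propositional.Properties as Unique
open import Data.List.Relation.Binary.Disjoint.Propositional using (Disjoint)
open import Data.List.Membership.Propositional using (_∈_; _∉_)
open import Data.List.Membership.Propositional.Properties
  using (∈-map⁺; ∈-map⁻; ∈-++⁺ˡ; ∈-++⁺ʳ; ∈-++⁻)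
open import Data.Product using (Σ; ∃₂; _×_; _,_; proj₁; proj₂)
open import Data.Sum using (inj₁; inj₂)
open import Data.Empty using (⊥; ⊥-elim)
open import Function using (_∘_)
open import Function.Bundles using (_⇔_; mk⇔)
open import Relation.Binary.Core using (_Preserves_⟶_)
open import Relation.Binary.Definitions using (tri<; tri≈; tri>)
open import Relation.Binary.PropositionalEquality
  using (_≡_; _≢_; refl; sym; trans; cong; cong₂; subst; module ≡-Reasoning)
open import Relation.Nullary using (¬_)
open import Data.Nat.Tactic.RingSolver using (solve-∀)

-- The neighbour list

leftSpine rightSpine : Tree → ℕ
leftSpine leaf       = 0
leftSpine (node L _) = suc (leftSpine L)
rightSpine leaf       = 0
rightSpine (node _ R) = suc (rightSpine R)

deleteLeftmost deleteRightmost : Tree → Tree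
deleteLeftmost leaf                  = leaf
deleteLeftmost (node leaf R)         = R
deleteLeftmost (node L@(node _ _) R) = node (deleteLeftmost L) R
deleteRightmost leaf                  = leaf
deleteRightmost (node L leaf)         = L
deleteRightmost (node L R@(node _ _)) = node L (deleteRightmost R)

-- The trees C(b ∷ r) over all values of b, where C(r) = T (resp. C(l ∷ʳ b), where C(l) = T).
insertLeftmost insertRightmost : Tree → List Tree
insertLeftmost leaf         = [ node leaf leaf ]
insertLeftmost T@(node L R) = node leaf T ∷ map (λ S → node S R) (insertLeftmost L)
insertRightmost leaf         = [ node leaf leaf ]
insertRightmost T@(node L R) = node T leaf ∷ map (node L) (insertRightmost R)

-- Swapping the root of C(x) = node L R with its left (right) neighbour in x.
rootSwapsˡ rootSwapsʳ : Tree → Tree → List Tree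
rootSwapsˡ leaf         R = []
rootSwapsˡ L@(node _ _) R = map (node (deleteRightmost L)) (insertLeftmost R)
rootSwapsʳ L leaf         = []
rootSwapsʳ L R@(node _ _) = map (λ S → node S (deleteLeftmost R)) (insertRightmost L)

rootSwaps : Tree → Tree → List Tree
rootSwaps L R = rootSwapsˡ L R ++ rootSwapsʳ L R

neighbours : Tree → List Tree
neighbours leaf       = []
neighbours (node L R) = map (λ S → node S R) (neighbours L) ++ rootSwaps L R ++ map (node L) (neighbours R)

length-∷ʳ : ∀ {A : Set} (xs : List A) x → length (xs ∷ʳ x) ≡ suc (length xs)
length-∷ʳ []       x = refl
length-∷ʳ (_ ∷ xs) x = cong suc (length-∷ʳ xs x)

Unique-++⁻ : ∀ {A : Set} (xs : List A) {ys} → Unique (xs ++ ys) → Unique xs × Unique ys × Disjoint xs ys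
Unique-++⁻ []       u        = [] , u , λ ()
Unique-++⁻ (x ∷ xs) (x∉ ∷ u) with Unique-++⁻ xs u
... | uxs , uys , disjoint = All.++⁻ˡ xs x∉ ∷ uxs , uys , λ where
  (here refl , v∈ys)   → All.lookup (All.++⁻ʳ xs x∉) v∈ys refl
  (there v∈xs , v∈ys) → disjoint (v∈xs , v∈ys)

Unique-insert : ∀ {A : Set} (xs : List A) {ys v} → Unique (xs ++ ys) → v ∉ xs ++ ys → Unique (xs ++ v ∷ ys)
Unique-insert []       {ys} u        v∉ = All.¬Any⇒All¬ ys v∉ ∷ u
Unique-insert (x ∷ xs)      (x∉ ∷ u) v∉ =
  All.++⁺ (All.++⁻ˡ xs x∉) ((λ x≡v → v∉ (here (sym x≡v))) ∷ All.++⁻ʳ xs x∉)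
  ∷ Unique-insert xs u (v∉ ∘ there)

All-disjoint : ∀ {A : Set} {P : A → Set} {xs ys} → All P xs → All (¬_ ∘ P) ys → Disjoint xs ys
All-disjoint pxs ¬pys (v∈xs , v∈ys) = All.lookup ¬pys v∈ys (All.lookup pxs v∈xs)

tau-cons : ∀ a x k → tau (a ∷ x) (suc (suc k)) ≡ a ∷ tau x (suc k)
tau-cons a []      k = refl
tau-cons a (_ ∷ _) k = refl

tau-map : ∀ (f : ℤ → ℤ) x i → tau (map f x) i ≡ map f (tau x i)
tau-map f []          i             = refl
tau-map f (a ∷ [])    zero          = refl
tau-map f (a ∷ [])    (suc zero)    = refl
tau-map f (a ∷ [])    (suc (suc i)) = refl
tau-map f (a ∷ b ∷ x) zero          = refl
tau-map f (a ∷ b ∷ x) (suc zero)    = refl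
tau-map f (a ∷ b ∷ x) (suc (suc i)) = cong (f a ∷_) (tau-map f (b ∷ x) (suc i))

All-tau : ∀ {P : ℤ → Set} x i → All P x → All P (tau x i)
All-tau []          i             p              = p
All-tau (a ∷ [])    zero          p              = p
All-tau (a ∷ [])    (suc zero)    p              = p
All-tau (a ∷ [])    (suc (suc i)) p              = p
All-tau (a ∷ b ∷ x) zero          p              = p
All-tau (a ∷ b ∷ x) (suc zero)    (pa ∷ pb ∷ p)  = pb ∷ pa ∷ p
All-tau (a ∷ b ∷ x) (suc (suc i)) (pa ∷ p)       = pa ∷ All-tau (b ∷ x) (suc i) p

tau-++ˡ : ∀ x y i → 1 ≤ i → i < length x → tau (x ++ y) i ≡ tau x i ++ y
tau-++ˡ (a ∷ b ∷ x) y (suc zero)    _ _         = refl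
tau-++ˡ (a ∷ x)     y (suc (suc i)) _ (s≤s i<) = begin
  tau (a ∷ x ++ y) (suc (suc i))   ≡⟨ tau-cons a (x ++ y) i ⟩
  a ∷ tau (x ++ y) (suc i)         ≡⟨ cong (a ∷_) (tau-++ˡ x y (suc i) (s≤s z≤n) i<) ⟩
  a ∷ tau x (suc i) ++ y           ≡⟨ cong (_++ y) (tau-cons a x i) ⟨
  tau (a ∷ x) (suc (suc i)) ++ y   ∎
  where open ≡-Reasoning

tau-++ʳ : ∀ x a y k → tau (x ++ a ∷ y) (suc (length x + suc k)) ≡ x ++ a ∷ tau y (suc k)
tau-++ʳ []      a y k = tau-cons a y k
tau-++ʳ (b ∷ x) a y k = trans (tau-cons b (x ++ a ∷ y) (length x + suc k)) (cong (b ∷_) (tau-++ʳ x a y k))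

tau-swap : ∀ x a b y → tau (x ++ a ∷ b ∷ y) (suc (length x)) ≡ x ++ b ∷ a ∷ y
tau-swap []      a b y = refl
tau-swap (c ∷ x) a b y = trans (tau-cons c (x ++ a ∷ b ∷ y) (length x)) (cong (c ∷_) (tau-swap x a b y))

tau-last-root : ∀ x b a y → tau ((x ∷ʳ b) ++ a ∷ y) (length (x ∷ʳ b)) ≡ x ++ a ∷ b ∷ y
tau-last-root x b a y = trans (cong₂ tau (∷ʳ-++ x b (a ∷ y)) (length-∷ʳ x b)) (tau-swap x b a y)

tau-root-first : ∀ x a b y → tau (x ++ a ∷ b ∷ y) (suc (length x)) ≡ (x ∷ʳ b) ++ a ∷ y
tau-root-first x a b y = trans (tau-swap x a b y) (sym (∷ʳ-++ x b (a ∷ y)))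

IsCart-[]⁻ : ∀ {x T} → IsCart x T → x ≡ [] → T ≡ leaf
IsCart-[]⁻ cart-[]                  _  = refl
IsCart-[]⁻ (cart-node {l} _ _ _ _) eq with () ← ++-conicalʳ l _ eq

IsCart-leaf⁻ : ∀ {x} → IsCart x leaf → x ≡ []
IsCart-leaf⁻ cart-[] = refl

minimum-split-unique : ∀ l a r l′ a′ r′ → l ++ a ∷ r ≡ l′ ++ a′ ∷ r′ →
  All (a ℤ.<_) l → All (a ℤ.<_) r → All (a′ ℤ.<_) l′ → All (a′ ℤ.<_) r′ →
  l ≡ l′ × a ≡ a′ × r ≡ r′
minimum-split-unique []      a r []       .a .r refl _ _ _ _ = refl , refl , refl
minimum-split-unique []      a _ (_ ∷ l′) _  _ refl _   a<r a′<l′ _    =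
  ⊥-elim (ℤ.<-asym (All.head a′<l′) (All.head (All.++⁻ʳ l′ a<r)))
minimum-split-unique (_ ∷ l) a _ []       _  _ refl a<l _   _    a′<r′ =
  ⊥-elim (ℤ.<-asym (All.head a<l) (All.head (All.++⁻ʳ l a′<r′)))
minimum-split-unique (b ∷ l) a r (b′ ∷ l′) a′ r′ eq a<l a<r a′<l′ a′<r′
  with refl , eq′ ← ∷-injective eq
  with refl , refl , refl ←
    minimum-split-unique l a r l′ a′ r′ eq′ (All.tail a<l) a<r (All.tail a′<l′) a′<r′
  = refl , refl , refl

IsCart-split : ∀ {x T l a r} → IsCart x T → x ≡ l ++ a ∷ r → All (a ℤ.<_) l → All (a ℤ.<_) r →
  ∃₂ λ L R → T ≡ node L R × IsCart l L × IsCart r R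
IsCart-split {l = l} cart-[] eq _ _ with () ← ++-conicalʳ l _ (sym eq)
IsCart-split {l = l} {a} {r} (cart-node {l′} {r′} {a′} a′<l′ a′<r′ cl cr) eq a<l a<r
  with refl , refl , refl ← minimum-split-unique l a r l′ a′ r′ (sym eq) a<l a<r a′<l′ a′<r′
  = _ , _ , refl , cl , cr

IsCart-functional : ∀ {x T S} → IsCart x T → IsCart x S → T ≡ S
IsCart-functional cart-[] d = sym (IsCart-[]⁻ d refl)
IsCart-functional (cart-node a<l a<r cl cr) d
  with _ , _ , refl , dl , dr ← IsCart-split d refl a<l a<r
  = cong₂ node (IsCart-functional cl dl) (IsCart-functional cr dr)

IsCart-length : ∀ {x T} → IsCart x T → length x ≡ size T
IsCart-length cart-[] = refl
IsCart-length (cart-node {l} {r} {Tl = L} {R} _ _ cl cr) = begin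
  length (l ++ _ ∷ r)       ≡⟨ length-++ l ⟩
  length l + suc (length r) ≡⟨ ℕ.+-suc (length l) (length r) ⟩
  suc (length l + length r) ≡⟨ cong suc (cong₂ _+_ (IsCart-length cl) (IsCart-length cr)) ⟩
  size (node L R)           ∎
  where open ≡-Reasoning

IsCart-map : ∀ {x T} (f : ℤ → ℤ) → f Preserves ℤ._<_ ⟶ ℤ._<_ → IsCart x T → IsCart (map f x) T
IsCart-map f mono cart-[] = cart-[]
IsCart-map f mono (cart-node {l} {r} {a} a<l a<r cl cr) =
  subst (λ y → IsCart y _) (sym (map-++ f l (a ∷ r)))
    (cart-node (All.map⁺ (All.map mono a<l)) (All.map⁺ (All.map mono a<r))
               (IsCart-map f mono cl) (IsCart-map f mono cr))

IsCart-init : ∀ {y T l b} → IsCart y T → y ≡ l ∷ʳ b → IsCart l (deleteRightmost T)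
IsCart-init {l = l} cart-[] eq with () ← ++-conicalʳ l _ (sym eq)
IsCart-init (cart-node {l′} {r} {a} a<l′ a<r cl cr) eq with reverseView r
IsCart-init (cart-node {l′} {a = a} _ _ cl cr) eq | []
  with refl , refl ← ∷ʳ-injective l′ _ eq | refl ← IsCart-[]⁻ cr refl = cl
IsCart-init (cart-node {Tr = leaf} _ _ _ cr) _ | r′ ∶ _ ∶ʳ _ with () ← ++-conicalʳ r′ _ (IsCart-leaf⁻ cr)
IsCart-init (cart-node {l′} {a = a} {Tr = node _ _} a<l′ a<r cl cr) eq | r′ ∶ _ ∶ʳ c
  with refl , refl ← ∷ʳ-injective (l′ ++ a ∷ r′) _ (trans (++-assoc l′ (a ∷ r′) [ c ]) eq)
  = cart-node a<l′ (All.++⁻ˡ r′ a<r) cl (IsCart-init cr refl)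

IsCart-tail : ∀ {y T b r} → IsCart y T → y ≡ b ∷ r → IsCart r (deleteLeftmost T)
IsCart-tail (cart-node {[]} _ _ cl cr) refl with refl ← IsCart-[]⁻ cl refl = cr
IsCart-tail (cart-node {_ ∷ l} {Tl = leaf} _ _ cl _) refl with () ← IsCart-leaf⁻ cl
IsCart-tail (cart-node {_ ∷ l} {Tl = node _ _} a<l a<r cl cr) refl =
  cart-node (All.tail a<l) a<r (IsCart-tail cl refl) cr

IsCart-singleton : ∀ {b S} → IsCart [ b ] S → S ≡ node leaf leaf
IsCart-singleton d with _ , _ , refl , dl , dr ← IsCart-split {l = []} d refl [] []
  with refl ← IsCart-[]⁻ dl refl | refl ← IsCart-[]⁻ dr refl = refl

All-<-lower : ∀ {b a} → b ℤ.< a → ∀ l r → All (a ℤ.<_) l → All (a ℤ.<_) r →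
  All (b ℤ.<_) (l ++ a ∷ r)
All-<-lower b<a l r a<l a<r = All.++⁺ (All.map (ℤ.<-trans b<a) a<l) (b<a ∷ All.map (ℤ.<-trans b<a) a<r)

IsCart-cons : ∀ {r R b S} → IsCart r R → IsCart (b ∷ r) S → b ∉ r → S ∈ insertLeftmost R
IsCart-cons cart-[] d _ = here (IsCart-singleton d)
IsCart-cons {b = b} (cart-node {l} {r} {a} a<l a<r cl cr) d b∉ with ℤ.<-cmp b a
... | tri< b<a _ _ =
  here (IsCart-functional d (cart-node [] (All-<-lower b<a l r a<l a<r) cart-[] (cart-node a<l a<r cl cr)))
... | tri≈ _ refl _ = ⊥-elim (b∉ (∈-++⁺ʳ l (here refl)))
... | tri> _ _ a<b
  with _ , _ , refl , dl , dr ← IsCart-split {l = b ∷ l} d refl (a<b ∷ a<l) a<r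
  with refl ← IsCart-functional dr cr
  = there (∈-map⁺ _ (IsCart-cons cl dl (b∉ ∘ ∈-++⁺ˡ)))

IsCart-snoc : ∀ {l L b S} → IsCart l L → IsCart (l ∷ʳ b) S → b ∉ l → S ∈ insertRightmost L
IsCart-snoc cart-[] d _ = here (IsCart-singleton d)
IsCart-snoc {b = b} (cart-node {l} {r} {a} a<l a<r cl cr) d b∉ with ℤ.<-cmp b a
... | tri< b<a _ _ =
  here (IsCart-functional d (cart-node (All-<-lower b<a l r a<l a<r) [] (cart-node a<l a<r cl cr) cart-[]))
... | tri≈ _ refl _ = ⊥-elim (b∉ (∈-++⁺ʳ l (here refl)))
... | tri> _ _ a<b
  with _ , _ , refl , dl , dr ← IsCart-split d (++-assoc l (a ∷ r) [ b ]) a<l (All.++⁺ a<r (a<b ∷ []))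
  with refl ← IsCart-functional dl cl
  = there (∈-map⁺ _ (IsCart-snoc cr dr (b∉ ∘ ∈-++⁺ʳ l ∘ there)))

IsCart-nonempty : ∀ {r R} → IsCart r R → 0 < size R → ∃₂ λ b r′ → r ≡ b ∷ r′
IsCart-nonempty {[]}    c 0<size with refl ← IsCart-[]⁻ c refl with () ← 0<size
IsCart-nonempty {b ∷ r} _ _ = b , r , refl

-- Every neighbour is listed

-- Where τ(x,i) acts, for x = l ++ a ∷ r and n = length l (positions are 1-based).
data SwapPosition (n : ℕ) : ℕ → Set where
  inside-left  : ∀ {i} → i < n → SwapPosition n i
  before-root  : SwapPosition n n
  after-root   : SwapPosition n (suc n)
  inside-right : ∀ k → SwapPosition n (suc (n + suc k))

swapPosition : ∀ n i → SwapPosition n i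
swapPosition zero    zero          = before-root
swapPosition zero    (suc zero)    = after-root
swapPosition zero    (suc (suc k)) = inside-right k
swapPosition (suc n) zero          = inside-left (s≤s z≤n)
swapPosition (suc n) (suc i) with swapPosition n i
... | inside-left i<n = inside-left (s≤s i<n)
... | before-root     = before-root
... | after-root      = after-root
... | inside-right k  = inside-right k

right-position : ∀ {n j L R} → n ≡ size L → suc (n + j) < size (node L R) → j < size R
right-position {n} refl h = ℕ.+-cancelˡ-< n _ _ (s≤s⁻¹ h)

∈-neighbours-left : ∀ {L R S} → S ∈ neighbours L → node S R ∈ neighbours (node L R)
∈-neighbours-left m = ∈-++⁺ˡ (∈-map⁺ _ m)

∈-neighbours-root : ∀ {L R S} → S ∈ rootSwaps L R → S ∈ neighbours (node L R)
∈-neighbours-root {L} m = ∈-++⁺ʳ (map _ (neighbours L)) (∈-++⁺ˡ m)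

∈-neighbours-right : ∀ {L R S} → S ∈ neighbours R → node L S ∈ neighbours (node L R)
∈-neighbours-right {L} {R} m = ∈-++⁺ʳ (map _ (neighbours L)) (∈-++⁺ʳ (rootSwaps L R) (∈-map⁺ _ m))

right-nonempty : ∀ {n L R} → n ≡ size L → suc n < size (node L R) → 0 < size R
right-nonempty {n} eq h = right-position {j = 0} eq (subst (λ k → suc k < _) (sym (ℕ.+-identityʳ n)) h)

before-root-∈ : ∀ {l a r L R S} → 0 < length l → Unique (l ++ a ∷ r) →
  All (a ℤ.<_) l → All (a ℤ.<_) r → IsCart l L → IsCart r R →
  IsCart (tau (l ++ a ∷ r) (length l)) S → S ∈ rootSwapsˡ L R
before-root-∈ {L = leaf} 0<l _ _ _ cl _ _ with refl ← IsCart-leaf⁻ cl with () ← 0<l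
before-root-∈ {l} {a} {r} {L = node _ _} 0<l ux a<l a<r cl cr d with reverseView l
... | [] with () ← 0<l
... | l′ ∶ _ ∶ʳ b
  with _ , _ , refl , d₁ , d₂ ←
    IsCart-split d (tau-last-root l′ b a r) (All.++⁻ˡ l′ a<l) (All.head (All.++⁻ʳ l′ a<l) ∷ a<r)
  with refl ← IsCart-functional d₁ (IsCart-init cl refl)
  = ∈-map⁺ _ (IsCart-cons cr d₂ b∉r)
  where
  b∉r : b ∉ r
  b∉r b∈r = proj₂ (proj₂ (Unique-++⁻ (l′ ∷ʳ b) ux)) (∈-++⁺ʳ l′ (here refl) , there b∈r)

after-root-∈ : ∀ {l a r L R S} → 0 < size R → Unique (l ++ a ∷ r) →
  All (a ℤ.<_) l → All (a ℤ.<_) r → IsCart l L → IsCart r R →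
  IsCart (tau (l ++ a ∷ r) (suc (length l))) S → S ∈ rootSwapsʳ L R
after-root-∈ {R = leaf} () _ _ _ _ _ _
after-root-∈ {l} {a} {R = node _ _} _ ux a<l a<r cl cr d
  with b , r′ , refl ← IsCart-nonempty cr (s≤s z≤n)
  with _ , _ , refl , d₁ , d₂ ←
    IsCart-split d (tau-root-first l a b r′) (All.++⁺ a<l (All.head a<r ∷ [])) (All.tail a<r)
  with refl ← IsCart-functional d₂ (IsCart-tail cr refl)
  = ∈-map⁺ _ (IsCart-snoc cl d₁ b∉l)
  where
  b∉l : b ∉ l
  b∉l b∈l = proj₂ (proj₂ (Unique-++⁻ l ux)) (b∈l , there (here refl))

swap-∈-neighbours : ∀ {x T S} i → 1 ≤ i → i < size T → Unique x → IsCart x T → IsCart (tau x i) S →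
  S ∈ neighbours T
swap-∈-neighbours i 1≤i i<m ux (cart-node {l} {r} {a} {L} {R} a<l a<r cl cr) d with swapPosition (length l) i
... | inside-left i<n
  with _ , _ , refl , d₁ , d₂ ← IsCart-split d (tau-++ˡ l (a ∷ r) i 1≤i i<n) (All-tau l i a<l) a<r
  with refl ← IsCart-functional d₂ cr
  = ∈-neighbours-left {L} {R} (swap-∈-neighbours i 1≤i i<L (proj₁ (Unique-++⁻ l ux)) cl d₁)
  where i<L = subst (i <_) (IsCart-length cl) i<n
... | before-root = ∈-neighbours-root {L} {R} (∈-++⁺ˡ (before-root-∈ 1≤i ux a<l a<r cl cr d))
... | after-root  = ∈-neighbours-root {L} {R} (∈-++⁺ʳ (rootSwapsˡ L R) (after-root-∈ 0<R ux a<l a<r cl cr d))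
  where 0<R = right-nonempty (IsCart-length cl) i<m
... | inside-right k
  with _ , _ , refl , d₁ , d₂ ← IsCart-split d (tau-++ʳ l a r k) a<l (All-tau r (suc k) a<r)
  with refl ← IsCart-functional d₁ cl
  with _ ∷ ur ← proj₁ (proj₂ (Unique-++⁻ l ux))
  = ∈-neighbours-right {L} {R} (swap-∈-neighbours (suc k) (s≤s z≤n) k<R ur cr d₂)
  where k<R = right-position (IsCart-length cl) i<m

-- The list has no repetitions

node-injectiveˡ : ∀ {A B C D} → node A B ≡ node C D → A ≡ C
node-injectiveˡ refl = refl

node-injectiveʳ : ∀ {A B C D} → node A B ≡ node C D → B ≡ D
node-injectiveʳ refl = refl

left : Tree → Tree
left leaf       = leaf
left (node L _) = L

deleteRightmost-size : ∀ A B → suc (size (deleteRightmost (node A B))) ≡ size (node A B)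
deleteRightmost-size A leaf       = cong suc (sym (ℕ.+-identityʳ (size A)))
deleteRightmost-size A (node C D) =
  cong suc (trans (sym (ℕ.+-suc (size A) _)) (cong (_+_ (size A)) (deleteRightmost-size C D)))

deleteLeftmost-size : ∀ A B → suc (size (deleteLeftmost (node A B))) ≡ size (node A B)
deleteLeftmost-size leaf       B = refl
deleteLeftmost-size (node C D) B = cong suc (cong (_+ size B) (deleteLeftmost-size C D))

insertLeftmost-size : ∀ T → All (λ S → size S ≡ suc (size T)) (insertLeftmost T)
insertLeftmost-size leaf       = refl ∷ []
insertLeftmost-size (node A B) = refl ∷ All.map⁺ (All.map (cong (λ n → suc (n + size B))) (insertLeftmost-size A))

insertRightmost-size : ∀ T → All (λ S → size S ≡ suc (size T)) (insertRightmost T)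
insertRightmost-size leaf       = refl ∷ []
insertRightmost-size (node A B) = cong suc (ℕ.+-identityʳ _) ∷
  All.map⁺ (All.map (λ e → cong suc (trans (cong (_+_ (size A)) e) (ℕ.+-suc (size A) (size B))))
                     (insertRightmost-size B))

insertLeftmost-unique : ∀ T → Unique (insertLeftmost T)
insertLeftmost-unique leaf       = [] ∷ []
insertLeftmost-unique (node A B) =
  All.map⁺ (All.map (λ e eq → ℕ.0≢1+n (trans (cong size (node-injectiveˡ eq)) e)) (insertLeftmost-size A))
  ∷ Unique.map⁺ node-injectiveˡ (insertLeftmost-unique A)

insertRightmost-unique : ∀ T → Unique (insertRightmost T)
insertRightmost-unique leaf       = [] ∷ []
insertRightmost-unique (node A B) =
  All.map⁺ (All.map (λ e eq → ℕ.0≢1+n (trans (cong size (node-injectiveʳ eq)) e)) (insertRightmost-size B))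
  ∷ Unique.map⁺ node-injectiveʳ (insertRightmost-unique B)

deleteLeftmost-insertLeftmost : ∀ T → All (λ S → deleteLeftmost S ≡ T) (insertLeftmost T)
deleteLeftmost-insertLeftmost leaf       = refl ∷ []
deleteLeftmost-insertLeftmost (node A B) =
  refl ∷ All.map⁺ (All.zipWith step (insertLeftmost-size A , deleteLeftmost-insertLeftmost A))
  where
  step : ∀ {S} → size S ≡ suc (size A) × deleteLeftmost S ≡ A → deleteLeftmost (node S B) ≡ node A B
  step {leaf}     (() , _)
  step {node _ _} (_ , e) = cong (λ X → node X B) e

deleteRightmost-insertRightmost : ∀ T → All (λ S → deleteRightmost S ≡ T) (insertRightmost T)
deleteRightmost-insertRightmost leaf       = refl ∷ []
deleteRightmost-insertRightmost (node A B) =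
  refl ∷ All.map⁺ (All.zipWith step (insertRightmost-size B , deleteRightmost-insertRightmost B))
  where
  step : ∀ {S} → size S ≡ suc (size B) × deleteRightmost S ≡ B → deleteRightmost (node A S) ≡ node A B
  step {leaf}     (() , _)
  step {node _ _} (_ , e) = cong (node A) e

rootSwapsˡ-size : ∀ L R → All (λ S → size S ≡ size (node L R)) (rootSwapsˡ L R)
rootSwapsˡ-size leaf       R = []
rootSwapsˡ-size (node A B) R = All.map⁺ (All.map step (insertLeftmost-size R))
  where
  d = size (deleteRightmost (node A B))
  step : ∀ {S} → size S ≡ suc (size R) → suc (d + size S) ≡ size (node (node A B) R)
  step e = cong suc (trans (cong (_+_ d) e)
                           (trans (ℕ.+-suc d (size R)) (cong (_+ size R) (deleteRightmost-size A B))))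

rootSwapsʳ-size : ∀ L R → All (λ S → size S ≡ size (node L R)) (rootSwapsʳ L R)
rootSwapsʳ-size L leaf       = []
rootSwapsʳ-size L (node A B) = All.map⁺ (All.map step (insertRightmost-size L))
  where
  d = size (deleteLeftmost (node A B))
  step : ∀ {S} → size S ≡ suc (size L) → suc (size S + d) ≡ size (node L (node A B))
  step e = cong suc (trans (cong (_+ d) e)
                           (trans (sym (ℕ.+-suc (size L) d)) (cong (_+_ (size L)) (deleteLeftmost-size A B))))

rootSwapsˡ-left : ∀ L R → All (λ S → suc (size (left S)) ≡ size L) (rootSwapsˡ L R)
rootSwapsˡ-left leaf       R = []
rootSwapsˡ-left (node A B) R = All.map⁺ (All.universal (λ _ → deleteRightmost-size A B) _)

rootSwapsʳ-left : ∀ L R → All (λ S → size (left S) ≡ suc (size L)) (rootSwapsʳ L R)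
rootSwapsʳ-left L leaf       = []
rootSwapsʳ-left L (node A B) = All.map⁺ (insertRightmost-size L)

rootSwaps-left : ∀ L R → All (λ S → size (left S) ≢ size L) (rootSwaps L R)
rootSwaps-left L R = All.++⁺
  (All.map (λ e e′ → ℕ.1+n≢n (trans e (sym e′))) (rootSwapsˡ-left L R))
  (All.map (λ e e′ → ℕ.1+n≢n (trans (sym e) e′)) (rootSwapsʳ-left L R))

neighbours-size : ∀ T → All (λ S → size S ≡ size T) (neighbours T)
neighbours-size leaf       = []
neighbours-size (node L R) = All.++⁺ (All.map⁺ (All.map (cong (λ n → suc (n + size R))) (neighbours-size L)))
  (All.++⁺ (All.++⁺ (rootSwapsˡ-size L R) (rootSwapsʳ-size L R))
           (All.map⁺ (All.map (cong (λ n → suc (size L + n))) (neighbours-size R))))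

neighbours-≢ : ∀ T → All (_≢ T) (neighbours T)
neighbours-≢ leaf       = []
neighbours-≢ (node L R) = All.++⁺ (All.map⁺ (All.map (λ S≢L → S≢L ∘ node-injectiveˡ) (neighbours-≢ L)))
  (All.++⁺ (All.map (λ ≢L eq → ≢L (cong (size ∘ left) eq)) (rootSwaps-left L R))
           (All.map⁺ (All.map (λ S≢R → S≢R ∘ node-injectiveʳ) (neighbours-≢ R))))

rootSwaps-unique : ∀ L R → Unique (rootSwaps L R)
rootSwaps-unique L R = Unique.++⁺ (uniqueˡ L R) (uniqueʳ L R)
  (All-disjoint (rootSwapsˡ-left L R)
    (All.map (λ e e′ → ℕ.m≢1+n+m (size L) (trans (sym e′) (cong suc e))) (rootSwapsʳ-left L R)))
  where
  uniqueˡ : ∀ L R → Unique (rootSwapsˡ L R)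
  uniqueˡ leaf       R = []
  uniqueˡ (node _ _) R = Unique.map⁺ node-injectiveʳ (insertLeftmost-unique R)
  uniqueʳ : ∀ L R → Unique (rootSwapsʳ L R)
  uniqueʳ L leaf       = []
  uniqueʳ L (node _ _) = Unique.map⁺ node-injectiveˡ (insertRightmost-unique L)

-- The blocks of neighbours (node L R) are told apart by the left subtree.
neighbours-unique : ∀ T → Unique (neighbours T)
neighbours-unique leaf       = []
neighbours-unique (node L R) =
  Unique.++⁺ (Unique.map⁺ node-injectiveˡ (neighbours-unique L))
    (Unique.++⁺ (rootSwaps-unique L R) (Unique.map⁺ node-injectiveʳ (neighbours-unique R))
      (All-disjoint (rootSwaps-left L R) (All.map⁺ (All.universal (λ _ ≢ → ≢ refl) _))))
    (All-disjoint {P = λ S → left S ≢ L × size (left S) ≡ size L}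
      (All.map⁺ (All.zip (neighbours-≢ L , neighbours-size L)))
      (All.++⁺ (All.map (λ ≢ (_ , e) → ≢ e) (rootSwaps-left L R))
               (All.map⁺ (All.universal (λ _ (≢ , _) → ≢ refl) _))))

-- Counting

count : Tree → ℕ
count T = length (neighbours T)

isNode : Tree → ℕ
isNode leaf       = 0
isNode (node _ _) = 1

spineWeight : Tree → ℕ
spineWeight T = isNode T + leftSpine T + rightSpine T

count-node : ∀ L R → count (node L R) ≡ count L + (length (rootSwaps L R) + count R)
count-node L R = begin
  length (map _ (neighbours L) ++ rootSwaps L R ++ map _ (neighbours R))
    ≡⟨ length-++ (map _ (neighbours L)) ⟩
  length (map _ (neighbours L)) + length (rootSwaps L R ++ map _ (neighbours R))
    ≡⟨ cong₂ _+_ (length-map _ (neighbours L)) (length-++ (rootSwaps L R)) ⟩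
  count L + (length (rootSwaps L R) + length (map _ (neighbours R)))
    ≡⟨ cong (λ n → count L + (length (rootSwaps L R) + n)) (length-map _ (neighbours R)) ⟩
  count L + (length (rootSwaps L R) + count R) ∎
  where open ≡-Reasoning

length-insertLeftmost : ∀ T → length (insertLeftmost T) ≡ suc (leftSpine T)
length-insertLeftmost leaf       = refl
length-insertLeftmost (node A B) = cong suc (trans (length-map _ (insertLeftmost A)) (length-insertLeftmost A))

length-insertRightmost : ∀ T → length (insertRightmost T) ≡ suc (rightSpine T)
length-insertRightmost leaf       = refl
length-insertRightmost (node A B) = cong suc (trans (length-map _ (insertRightmost B)) (length-insertRightmost B))

length-rootSwapsˡ : ∀ L R → length (rootSwapsˡ L R) ≡ isNode L * suc (leftSpine R)
length-rootSwapsˡ leaf       R = refl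
length-rootSwapsˡ (node A B) R =
  trans (length-map _ (insertLeftmost R)) (trans (length-insertLeftmost R) (sym (ℕ.+-identityʳ _)))

length-rootSwapsʳ : ∀ L R → length (rootSwapsʳ L R) ≡ isNode R * suc (rightSpine L)
length-rootSwapsʳ L leaf       = refl
length-rootSwapsʳ L (node A B) =
  trans (length-map _ (insertRightmost L)) (trans (length-insertRightmost L) (sym (ℕ.+-identityʳ _)))

isNode-*-bounds : ∀ T k → isNode T ≤ isNode T * suc k × isNode T * suc k ≤ isNode T + k
isNode-*-bounds leaf       k = z≤n , z≤n
isNode-*-bounds (node _ _) k = s≤s z≤n , ℕ.≤-reflexive (ℕ.+-identityʳ _)

length-rootSwaps : ∀ L R → length (rootSwaps L R) ≡ isNode L * suc (leftSpine R) + isNode R * suc (rightSpine L)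
length-rootSwaps L R =
  trans (length-++ (rootSwapsˡ L R)) (cong₂ _+_ (length-rootSwapsˡ L R) (length-rootSwapsʳ L R))

rootSwaps-lower : ∀ L R → isNode L + isNode R ≤ length (rootSwaps L R)
rootSwaps-lower L R = subst (isNode L + isNode R ≤_) (sym (length-rootSwaps L R))
  (ℕ.+-mono-≤ (proj₁ (isNode-*-bounds L _)) (proj₁ (isNode-*-bounds R _)))

rootSwaps-upper : ∀ L R → length (rootSwaps L R) ≤ (isNode L + leftSpine R) + (isNode R + rightSpine L)
rootSwaps-upper L R = subst (_≤ (isNode L + leftSpine R) + (isNode R + rightSpine L)) (sym (length-rootSwaps L R))
  (ℕ.+-mono-≤ (proj₂ (isNode-*-bounds L _)) (proj₂ (isNode-*-bounds R _)))

3≤spineWeight : ∀ A B → 3 ≤ spineWeight (node A B)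
3≤spineWeight A B = s≤s (s≤s (ℕ.≤-trans (s≤s z≤n) (ℕ.m≤n+m _ (leftSpine A))))

rootSwaps+2≤spineWeight : ∀ L R → 2 ≤ size (node L R) →
  length (rootSwaps L R) + 2 ≤ spineWeight L + spineWeight R
rootSwaps+2≤spineWeight leaf       leaf       (s≤s ())
rootSwaps+2≤spineWeight leaf       (node C D) _ = 3≤spineWeight C D
rootSwaps+2≤spineWeight (node A B) leaf       _ = subst (3 ≤_) (sym (ℕ.+-identityʳ _)) (3≤spineWeight A B)
rootSwaps+2≤spineWeight (node A B) (node C D) _ = begin
  length (rootSwaps (node A B) (node C D)) + 2          ≡⟨ cong (_+ 2) (length-rootSwaps (node A B) (node C D)) ⟩
  (1 * suc (suc lC) + 1 * suc (suc rB)) + 2            ≡⟨ shuffle₁ lC rB ⟩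
  lC + rB + 6                                          ≤⟨ ℕ.m≤n+m _ (lA + rD) ⟩
  (lA + rD) + (lC + rB + 6)                            ≡⟨ shuffle₂ lA rB lC rD ⟩
  spineWeight (node A B) + spineWeight (node C D)      ∎
  where
  open ℕ.≤-Reasoning
  lA = leftSpine A
  rB = rightSpine B
  lC = leftSpine C
  rD = rightSpine D
  shuffle₁ : ∀ c b → (1 * suc (suc c) + 1 * suc (suc b)) + 2 ≡ c + b + 6
  shuffle₁ = solve-∀
  shuffle₂ : ∀ a b c d → (a + d) + (c + b + 6) ≡ (1 + suc a + suc b) + (1 + suc c + suc d)
  shuffle₂ = solve-∀

size≤count+isNode : ∀ T → size T ≤ count T + isNode T
children-size≤count : ∀ L R → size L + size R ≤ count (node L R)

size≤count+isNode leaf       = z≤n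
size≤count+isNode (node L R) = subst (size (node L R) ≤_) (ℕ.+-comm 1 _) (s≤s (children-size≤count L R))

children-size≤count L R = begin
  size L + size R                               ≤⟨ ℕ.+-mono-≤ (size≤count+isNode L) (size≤count+isNode R) ⟩
  (count L + isNode L) + (count R + isNode R)   ≡⟨ shuffle (count L) (isNode L) (count R) (isNode R) ⟩
  count L + ((isNode L + isNode R) + count R)
    ≤⟨ ℕ.+-monoʳ-≤ (count L) (ℕ.+-monoˡ-≤ (count R) (rootSwaps-lower L R)) ⟩
  count L + (length (rootSwaps L R) + count R)  ≡⟨ count-node L R ⟨
  count (node L R)                              ∎
  where
  open ℕ.≤-Reasoning
  shuffle : ∀ c n c′ n′ → (c + n) + (c′ + n′) ≡ c + ((n + n′) + c′)
  shuffle = solve-∀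

count+spineWeight≤3*size : ∀ T → count T + spineWeight T ≤ 3 * size T

subtrees-count+spineWeight≤3*size : ∀ L R →
  (count L + spineWeight L) + (count R + spineWeight R) + 3 ≤ 3 * size (node L R)
subtrees-count+spineWeight≤3*size L R = begin
  (count L + spineWeight L) + (count R + spineWeight R) + 3
    ≤⟨ ℕ.+-monoˡ-≤ 3 (ℕ.+-mono-≤ (count+spineWeight≤3*size L) (count+spineWeight≤3*size R)) ⟩
  3 * size L + 3 * size R + 3 ≡⟨ distrib (size L) (size R) ⟩
  3 * size (node L R)         ∎
  where
  open ℕ.≤-Reasoning
  distrib : ∀ s s′ → 3 * s + 3 * s′ + 3 ≡ 3 * suc (s + s′)
  distrib = solve-∀

count+spineWeight≤3*size leaf       = z≤n
count+spineWeight≤3*size (node L R) = begin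
  count (node L R) + spineWeight (node L R)
    ≡⟨ cong (_+ spineWeight (node L R)) (count-node L R) ⟩
  (cL + (length (rootSwaps L R) + cR)) + (1 + suc lL + suc rR)
    ≤⟨ ℕ.+-monoˡ-≤ _ (ℕ.+-monoʳ-≤ cL (ℕ.+-monoˡ-≤ cR (rootSwaps-upper L R))) ⟩
  (cL + ((nL + lR) + (nR + rL) + cR)) + (1 + suc lL + suc rR)
    ≡⟨ shuffle cL cR nL nR lL lR rL rR ⟩
  (cL + spineWeight L) + (cR + spineWeight R) + 3
    ≤⟨ subtrees-count+spineWeight≤3*size L R ⟩
  3 * size (node L R) ∎
  where
  open ℕ.≤-Reasoning
  cL = count L
  cR = count R
  nL = isNode L
  nR = isNode R
  lL = leftSpine L
  lR = leftSpine R
  rL = rightSpine L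
  rR = rightSpine R
  shuffle : ∀ cL cR nL nR lL lR rL rR →
    (cL + ((nL + lR) + (nR + rL) + cR)) + (1 + suc lL + suc rR) ≡ (cL + (nL + lL + rL)) + (cR + (nR + lR + rR)) + 3
  shuffle = solve-∀

count+5≤3*size : ∀ L R → 2 ≤ size (node L R) → count (node L R) + 5 ≤ 3 * size (node L R)
count+5≤3*size L R 2≤size = begin
  count (node L R) + 5                                  ≡⟨ cong (_+ 5) (count-node L R) ⟩
  (cL + (length (rootSwaps L R) + cR)) + 5              ≡⟨ shuffle₁ cL _ cR ⟩
  (cL + cR) + (length (rootSwaps L R) + 2) + 3
    ≤⟨ ℕ.+-monoˡ-≤ 3 (ℕ.+-monoʳ-≤ (cL + cR) (rootSwaps+2≤spineWeight L R 2≤size)) ⟩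
  (cL + cR) + (spineWeight L + spineWeight R) + 3       ≡⟨ shuffle₂ cL cR (spineWeight L) (spineWeight R) ⟩
  (cL + spineWeight L) + (cR + spineWeight R) + 3       ≤⟨ subtrees-count+spineWeight≤3*size L R ⟩
  3 * size (node L R)                                   ∎
  where
  open ℕ.≤-Reasoning
  cL = count L
  cR = count R
  shuffle₁ : ∀ c m c′ → (c + (m + c′)) + 5 ≡ (c + c′) + (m + 2) + 3
  shuffle₁ = solve-∀
  shuffle₂ : ∀ c c′ w w′ → (c + c′) + (w + w′) + 3 ≡ (c + w) + (c′ + w′) + 3
  shuffle₂ = solve-∀

-- Realizing sequences

Below : ℕ → ℤ → Set
Below B (+ n)    = n < B
Below B -[1+ _ ] = ⊥

liftℕ : (ℕ → ℕ) → ℤ → ℤ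
liftℕ g (+ n)    = + g n
liftℕ g -[1+ n ] = -[1+ n ]

liftℕ-mono : ∀ {g} → g Preserves _<_ ⟶ _<_ → liftℕ g Preserves ℤ._<_ ⟶ ℤ._<_
liftℕ-mono mono (ℤ.-<- n<m) = ℤ.-<- n<m
liftℕ-mono mono ℤ.-<+       = ℤ.-<+
liftℕ-mono mono (ℤ.+<+ m<n) = ℤ.+<+ (mono m<n)

mono⇒injective : ∀ {f : ℤ → ℤ} → f Preserves ℤ._<_ ⟶ ℤ._<_ → ∀ {u v} → f u ≡ f v → u ≡ v
mono⇒injective mono {u} {v} eq with ℤ.<-cmp u v
... | tri< u<v _ _ = ⊥-elim (ℤ.<⇒≢ (mono u<v) eq)
... | tri≈ _ u≡v _ = u≡v
... | tri> _ _ v<u = ⊥-elim (ℤ.<⇒≢ (mono v<u) (sym eq))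

rooted : List ℤ → List ℤ → List ℤ
rooted x y = map (liftℕ suc) x ++ + 0 ∷ map (liftℕ suc) y

Below-≤ : ∀ {B B′} → B ≤ B′ → ∀ {v} → Below B v → Below B′ v
Below-≤ B≤B′ {+ _} v<B = ℕ.<-≤-trans v<B B≤B′

Below-liftℕ : ∀ {B B′} g → (∀ {n} → n < B → g n < B′) → ∀ {v} → Below B v → Below B′ (liftℕ g v)
Below-liftℕ g g< {+ _} v<B = g< v<B

0<liftℕ-suc : ∀ {B} v → Below B v → + 0 ℤ.< liftℕ suc v
0<liftℕ-suc (+ _) _ = ℤ.+<+ (s≤s z≤n)

rooted-cart : ∀ {x y L R B B′} → All (Below B) x → All (Below B′) y → IsCart x L → IsCart y R →
  IsCart (rooted x y) (node L R)
rooted-cart bx by cx cy = cart-node (positive bx) (positive by) (raise cx) (raise cy)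
  where
  positive : ∀ {B z} → All (Below B) z → All (+ 0 ℤ.<_) (map (liftℕ suc) z)
  positive = All.map⁺ ∘ All.map (0<liftℕ-suc _)
  raise : ∀ {z T} → IsCart z T → IsCart (map (liftℕ suc) z) T
  raise = IsCart-map (liftℕ suc) (liftℕ-mono s≤s)

rooted-unique : ∀ {B} x {y} → All (Below B) (x ++ y) → Unique (x ++ y) → Unique (rooted x y)
rooted-unique x {y} b u = Unique-insert (map (liftℕ suc) x)
  (subst Unique (map-++ _ x y) (Unique.map⁺ (mono⇒injective (liftℕ-mono s≤s)) u))
  (λ 0∈ → 0∉ (subst (+ 0 ∈_) (sym (map-++ _ x y)) 0∈))
  where
  0∉ : + 0 ∉ map (liftℕ suc) (x ++ y)
  0∉ 0∈ with v , v∈ , eq ← ∈-map⁻ _ 0∈ = ℤ.<⇒≢ (0<liftℕ-suc v (All.lookup b v∈)) eq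

rooted-below : ∀ {B} x {y} → All (Below B) (x ++ y) → All (Below (suc B)) (rooted x y)
rooted-below {B} x {y} b = All.++⁺ (below-suc (All.++⁻ˡ x b)) (s≤s z≤n ∷ below-suc (All.++⁻ʳ x b))
  where
  below-suc : ∀ {z} → All (Below B) z → All (Below (suc B)) (map (liftℕ suc) z)
  below-suc = All.map⁺ ∘ All.map (Below-liftℕ suc s≤s)

shift : ℕ → List ℤ → List ℤ
shift B = map (liftℕ (_+_ B))

shift-cart : ∀ {y R} B → IsCart y R → IsCart (shift B y) R
shift-cart B = IsCart-map (liftℕ (_+_ B)) (liftℕ-mono (ℕ.+-monoʳ-< B))

shift-below : ∀ {y B′} B → All (Below B′) y → All (Below (B + B′)) (shift B y)
shift-below B = All.map⁺ ∘ All.map (Below-liftℕ (_+_ B) (ℕ.+-monoʳ-< B))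

++-shift-unique : ∀ {x y B} → All (Below B) x → Unique x → Unique y → Unique (x ++ shift B y)
++-shift-unique {B = B} bx ux uy =
  Unique.++⁺ ux (Unique.map⁺ (mono⇒injective (liftℕ-mono (ℕ.+-monoʳ-< B))) uy)
  (All-disjoint bx (All.map⁺ (All.universal shifted-above _)))
  where
  shifted-above : ∀ v → ¬ Below B (liftℕ (_+_ B) v)
  shifted-above (+ n) = ℕ.m+n≮m B n

++-shift-below : ∀ {x y B B′} → All (Below B) x → All (Below B′) y → All (Below (B + B′)) (x ++ shift B y)
++-shift-below {B = B} bx by = All.++⁺ (All.map (Below-≤ (ℕ.m≤m+n B _)) bx) (shift-below B by)

tau-rooted-left : ∀ x y i → 1 ≤ i → i < length x → tau (rooted x y) i ≡ rooted (tau x i) y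
tau-rooted-left x y i 1≤i i<x = begin
  tau (map s x ++ + 0 ∷ map s y) i  ≡⟨ tau-++ˡ (map s x) _ i 1≤i (subst (i <_) (sym (length-map s x)) i<x) ⟩
  tau (map s x) i ++ + 0 ∷ map s y  ≡⟨ cong (_++ _) (tau-map s x i) ⟩
  rooted (tau x i) y                ∎
  where
  open ≡-Reasoning
  s = liftℕ suc

tau-rooted-right : ∀ x y k → tau (rooted x y) (suc (length x + suc k)) ≡ rooted x (tau y (suc k))
tau-rooted-right x y k = begin
  tau (map s x ++ + 0 ∷ map s y) (suc (length x + suc k))
    ≡⟨ cong (λ n → tau (rooted x y) (suc (n + suc k))) (length-map s x) ⟨
  tau (map s x ++ + 0 ∷ map s y) (suc (length (map s x) + suc k))
    ≡⟨ tau-++ʳ (map s x) (+ 0) (map s y) k ⟩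
  map s x ++ + 0 ∷ tau (map s y) (suc k)
    ≡⟨ cong (λ z → map s x ++ + 0 ∷ z) (tau-map s y (suc k)) ⟩
  rooted x (tau y (suc k)) ∎
  where
  open ≡-Reasoning
  s = liftℕ suc

rooted-∷ʳ : ∀ x u y → rooted (x ∷ʳ u) y ≡ map (liftℕ suc) x ++ liftℕ suc u ∷ + 0 ∷ map (liftℕ suc) y
rooted-∷ʳ x u y = trans (cong (_++ _) (map-++ (liftℕ suc) x [ u ])) (++-assoc (map (liftℕ suc) x) _ _)

tau-rooted-rootˡ : ∀ x u y → tau (rooted (x ∷ʳ u) y) (suc (length x)) ≡ rooted x (u ∷ y)
tau-rooted-rootˡ x u y = trans (cong₂ tau (rooted-∷ʳ x u y) (cong suc (sym (length-map (liftℕ suc) x))))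
  (tau-swap (map (liftℕ suc) x) _ _ _)

tau-rooted-rootʳ : ∀ x u y → tau (rooted x (u ∷ y)) (suc (length x)) ≡ rooted (x ∷ʳ u) y
tau-rooted-rootʳ x u y = trans (cong (tau (rooted x (u ∷ y))) (cong suc (sym (length-map (liftℕ suc) x))))
  (trans (tau-swap (map (liftℕ suc) x) _ _ _) (sym (rooted-∷ʳ x u y)))

record Realization (T : Tree) : Set where
  constructor realization
  field
    bound   : ℕ
    entries : List ℤ
    unique  : Unique entries
    below   : All (Below bound) entries
    cart    : IsCart entries T

node-realization : ∀ {L R} → Realization L → Realization R → Realization (node L R)
node-realization (realization B x ux bx cx) (realization B′ y uy by cy) =
  realization (suc (B + B′)) (rooted x (shift B y))
    (rooted-unique x (++-shift-below bx by) (++-shift-unique bx ux uy))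
    (rooted-below x (++-shift-below bx by))
    (rooted-cart bx (shift-below B by) cx (shift-cart B cy))

realize : ∀ T → Realization T
realize leaf       = realization 0 [] [] [] cart-[]
realize (node L R) = node-realization (realize L) (realize R)

-- Ng T S with bounded entries, which the gluing constructions below require.
record NeighbourRealization (T S : Tree) : Set where
  constructor neighbour-realization
  field
    position   : ℕ
    1≤position : 1 ≤ position
    position<  : position < size T
    realizer   : Realization T
    swapped    : IsCart (tau (Realization.entries realizer) position) S

node-neighbourˡ : ∀ {L R S} → NeighbourRealization L S → Realization R →
  NeighbourRealization (node L R) (node S R)
node-neighbourˡ (neighbour-realization i 1≤i i<L ρ@(realization B x _ bx cx) sw)
                ρR@(realization B′ y _ by cy) =
  neighbour-realization i 1≤i (ℕ.≤-trans i<L (ℕ.m≤n⇒m≤1+n (ℕ.m≤m+n _ _))) (node-realization ρ ρR)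
    (subst (λ z → IsCart z _)
      (sym (tau-rooted-left x (shift B y) i 1≤i (subst (i <_) (sym (IsCart-length cx)) i<L)))
      (rooted-cart (All-tau x i bx) (shift-below B by) sw (shift-cart B cy)))

node-neighbourʳ : ∀ {L R S} → Realization L → NeighbourRealization R S →
  NeighbourRealization (node L R) (node L S)
node-neighbourʳ {L} {R} ρL@(realization B x _ bx cx)
                (neighbour-realization (suc k) _ k<R ρ@(realization B′ y _ by cy) sw) =
  neighbour-realization (suc (length x + suc k)) (s≤s z≤n) (s≤s position<) (node-realization ρL ρ)
    (subst (λ z → IsCart z _)
      (sym (trans (tau-rooted-right x (shift B y) k) (cong (rooted x) (tau-map _ y (suc k)))))
      (rooted-cart bx (shift-below B (All-tau y (suc k) by)) cx (shift-cart B sw)))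
  where
  position< : length x + suc k < size L + size R
  position< = subst (λ n → length x + suc k < n + size R) (IsCart-length cx)
    (subst (_≤ length x + size R) (ℕ.+-suc (length x) (suc k)) (ℕ.+-monoʳ-≤ (length x) k<R))

-- Root swaps by amalgamation

m*n+o<m*p : ∀ m {n o p} → o < m → n < p → m * n + o < m * p
m*n+o<m*p m {n} {o} {p} o<m n<p = begin-strict
  m * n + o  <⟨ ℕ.+-monoʳ-< (m * n) o<m ⟩
  m * n + m  ≡⟨ ℕ.+-comm (m * n) m ⟩
  m + m * n  ≡⟨ ℕ.*-suc m n ⟨
  m * suc n  ≤⟨ ℕ.*-monoʳ-≤ m n<p ⟩
  m * p      ∎
  where open ℕ.≤-Reasoning

m*n+o≡m*p+q⇒n≡p : ∀ m {n o p q} → o < m → q < m → m * n + o ≡ m * p + q → n ≡ p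
m*n+o≡m*p+q⇒n≡p m {n} {o} {p} {q} o<m q<m eq with ℕ.<-cmp n p
... | tri< n<p _ _ = ⊥-elim (ℕ.<⇒≢ (ℕ.<-≤-trans (m*n+o<m*p m o<m n<p) (ℕ.m≤m+n (m * p) q)) eq)
... | tri≈ _ n≡p _ = n≡p
... | tri> _ _ p<n = ⊥-elim (ℕ.<⇒≢ (ℕ.<-≤-trans (m*n+o<m*p m q<m p<n) (ℕ.m≤m+n (m * n) o)) (sym eq))

-- Order-embeddings of p ∷ʳ c and d ∷ q (entries below B and M) into one sequence, identifying c with d:
-- the first is scaled by M, and the second fills the gap of width M at the image of c.
module Amalgamation (M c d : ℕ) .{{_ : NonZero M}} where

  F G : ℤ → ℤ
  F = liftℕ (λ v → M * v + d)
  G = liftℕ (λ w → M * c + w)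

  F-mono : F Preserves ℤ._<_ ⟶ ℤ._<_
  F-mono = liftℕ-mono (λ v<w → ℕ.+-monoˡ-< d (ℕ.*-monoʳ-< M v<w))

  G-mono : G Preserves ℤ._<_ ⟶ ℤ._<_
  G-mono = liftℕ-mono (ℕ.+-monoʳ-< (M * c))

  F≡G⇒≡c : ∀ {B} v w → Below B v → Below M w → d < M → F v ≡ G w → v ≡ + c
  F≡G⇒≡c (+ v) (+ w) _ w<M d<M eq = cong +_ (m*n+o≡m*p+q⇒n≡p M d<M w<M (ℤ.+-injective eq))

  amalgam-unique : ∀ {p q B} → Unique (p ∷ʳ + c) → All (Below B) (p ∷ʳ + c) →
    Unique (+ d ∷ q) → All (Below M) (+ d ∷ q) → Unique (map F p ++ map G (+ d ∷ q))
  amalgam-unique {p} {q} up bp uq bq with Unique-++⁻ p up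
  ... | up′ , _ , c∉p =
    Unique.++⁺ (Unique.map⁺ (mono⇒injective F-mono) up′) (Unique.map⁺ (mono⇒injective G-mono) uq) disjoint
    where
    disjoint : Disjoint (map F p) (map G (+ d ∷ q))
    disjoint (Fv∈ , Gw∈) with v , v∈p , refl ← ∈-map⁻ F Fv∈ | w , w∈q , eq ← ∈-map⁻ G Gw∈
      with refl ← F≡G⇒≡c v w (All.lookup (All.++⁻ˡ p bp) v∈p) (All.lookup bq w∈q) (All.head bq) eq
      = c∉p (v∈p , here refl)

  amalgam-below : ∀ {p q B} → All (Below B) (p ∷ʳ + c) → All (Below M) (+ d ∷ q) →
    All (Below (M * B)) (map F p ++ map G (+ d ∷ q))
  amalgam-below {p} bp bq = All.++⁺
    (All.map⁺ (All.map (Below-liftℕ _ (m*n+o<m*p M (All.head bq))) (All.++⁻ˡ p bp)))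
    (All.map⁺ (All.map (Below-liftℕ _ (λ w<M → m*n+o<m*p M w<M (All.head (All.++⁻ʳ p bp)))) bq))

record Amalgam (A B : Tree) : Set where
  constructor amalgam
  field
    bound : ℕ
    x y   : List ℤ
    u     : ℤ
    unique : Unique (x ++ u ∷ y)
    below  : All (Below bound) (x ++ u ∷ y)
    cartˡ  : IsCart (x ∷ʳ u) A
    cartʳ  : IsCart (u ∷ y) B

amalgamate : ∀ {A₁ A₂ B₁ B₂} → Realization (node A₁ A₂) → Realization (node B₁ B₂) →
  Amalgam (node A₁ A₂) (node B₁ B₂)
amalgamate (realization B e ue be ce) (realization M e′ ue′ be′ ce′) with reverseView e | e′
... | [] | _ with () ← IsCart-[]⁻ ce refl
... | _  | [] with () ← IsCart-[]⁻ ce′ refl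
... | p ∶ _ ∶ʳ -[1+ _ ] | _ with () ← All.head (All.++⁻ʳ p be)
... | _ | -[1+ _ ] ∷ _ with () ← All.head be′
... | p ∶ _ ∶ʳ + c | + d ∷ q =
  amalgam (M * B) (map F p) (map G q) (+ (M * c + d)) (amalgam-unique ue be ue′ be′) (amalgam-below be be′)
    (subst (λ z → IsCart z _) (map-++ F p [ + c ]) (IsCart-map F F-mono ce)) (IsCart-map G G-mono ce′)
  where open Amalgamation M c d {{>-nonZero (ℕ.≤-<-trans z≤n (All.head be′))}}

root-swap-realizations : ∀ {A₁ A₂ B₁ B₂} → let A = node A₁ A₂; B = node B₁ B₂ in Amalgam A B →
  NeighbourRealization (node A (deleteLeftmost B)) (node (deleteRightmost A) B) ×
  NeighbourRealization (node (deleteRightmost A) B) (node A (deleteLeftmost B))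
root-swap-realizations {A₁} {A₂} {B₁} {B₂} (amalgam K x y u uz bz cA cB) =
  neighbour-realization (suc (length x)) (s≤s z≤n) position₁ (realization (suc K) x₁ ux₁ bx₁ c₁)
    (subst (λ z → IsCart z _) (sym (tau-rooted-rootˡ x u y)) c₂) ,
  neighbour-realization (suc (length x)) (s≤s z≤n) position₂ (realization (suc K) x₂ ux₂ bx₂ c₂)
    (subst (λ z → IsCart z _) (sym (tau-rooted-rootʳ x u y)) c₁)
  where
  A = node A₁ A₂
  B = node B₁ B₂
  x₁ = rooted (x ∷ʳ u) y
  x₂ = rooted x (u ∷ y)
  length-x : length x ≡ size (deleteRightmost A)
  length-x = IsCart-length (IsCart-init cA refl)
  bz′ : All (Below K) ((x ∷ʳ u) ++ y)
  bz′ = subst (All (Below K)) (sym (∷ʳ-++ x u y)) bz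
  ux₁ = rooted-unique (x ∷ʳ u) bz′ (subst Unique (sym (∷ʳ-++ x u y)) uz)
  bx₁ = rooted-below (x ∷ʳ u) bz′
  c₁ : IsCart x₁ (node A (deleteLeftmost B))
  c₁ = rooted-cart (All.++⁻ˡ (x ∷ʳ u) bz′) (All.++⁻ʳ (x ∷ʳ u) bz′) cA (IsCart-tail cB refl)
  ux₂ = rooted-unique x bz uz
  bx₂ = rooted-below x bz
  c₂ : IsCart x₂ (node (deleteRightmost A) B)
  c₂ = rooted-cart (All.++⁻ˡ x bz) (All.++⁻ʳ x bz) (IsCart-init cA refl) cB
  position₁ : suc (length x) < size (node A (deleteLeftmost B))
  position₁ = s≤s (subst (_≤ size A + size (deleteLeftmost B))
                         (sym (trans (cong suc length-x) (deleteRightmost-size A₁ A₂))) (ℕ.m≤m+n (size A) _))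
  position₂ : suc (length x) < size (node (deleteRightmost A) B)
  position₂ = s≤s (subst (λ n → suc (length x) ≤ n + size B) length-x (ℕ.m<m+n (length x) (s≤s z≤n)))

rootSwapsˡ-realization : ∀ L R {S} → S ∈ rootSwapsˡ L R → NeighbourRealization (node L R) S
rootSwapsˡ-realization (node A₁ A₂) R S∈ with S₂ , S₂∈ , refl ← ∈-map⁻ _ S∈ =
  via-root-swap S₂ (All.lookup (insertLeftmost-size R) S₂∈)
                   (All.lookup (deleteLeftmost-insertLeftmost R) S₂∈)
  where
  via-root-swap : ∀ S₂ → size S₂ ≡ suc (size R) → deleteLeftmost S₂ ≡ R →
    NeighbourRealization (node (node A₁ A₂) R) (node (deleteRightmost (node A₁ A₂)) S₂)
  via-root-swap (node _ _) _ refl = proj₁ (root-swap-realizations (amalgamate (realize _) (realize _)))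

rootSwapsʳ-realization : ∀ L R {S} → S ∈ rootSwapsʳ L R → NeighbourRealization (node L R) S
rootSwapsʳ-realization L (node B₁ B₂) S∈ with S₁ , S₁∈ , refl ← ∈-map⁻ _ S∈ =
  via-root-swap S₁ (All.lookup (insertRightmost-size L) S₁∈)
                   (All.lookup (deleteRightmost-insertRightmost L) S₁∈)
  where
  via-root-swap : ∀ S₁ → size S₁ ≡ suc (size L) → deleteRightmost S₁ ≡ L →
    NeighbourRealization (node L (node B₁ B₂)) (node S₁ (deleteLeftmost (node B₁ B₂)))
  via-root-swap (node _ _) _ refl = proj₂ (root-swap-realizations (amalgamate (realize _) (realize _)))

-- Every listed tree is a neighbour

∈-neighbours-realization : ∀ T {S} → S ∈ neighbours T → NeighbourRealization T S
∈-neighbours-realization (node L R) S∈ with ∈-++⁻ (map _ (neighbours L)) S∈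
... | inj₁ S∈ˡ with S′ , S′∈ , refl ← ∈-map⁻ _ S∈ˡ =
  node-neighbourˡ (∈-neighbours-realization L S′∈) (realize R)
... | inj₂ S∈′ with ∈-++⁻ (rootSwaps L R) S∈′
...   | inj₂ S∈ʳ with S′ , S′∈ , refl ← ∈-map⁻ _ S∈ʳ =
  node-neighbourʳ (realize L) (∈-neighbours-realization R S′∈)
...   | inj₁ S∈root with ∈-++⁻ (rootSwapsˡ L R) S∈root
...     | inj₁ S∈swapˡ = rootSwapsˡ-realization L R S∈swapˡ
...     | inj₂ S∈swapʳ = rootSwapsʳ-realization L R S∈swapʳ

∈-neighbours⇔Ng : ∀ T S → S ∈ neighbours T ⇔ Ng T S
∈-neighbours⇔Ng T S = mk⇔ to from
  where
  to : S ∈ neighbours T → Ng T S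
  to S∈ with neighbour-realization i 1≤i i< (realization _ x ux _ cx) sw ← ∈-neighbours-realization T S∈
    = i , 1≤i , i< , x , ux , cx , sw
  from : Ng T S → S ∈ neighbours T
  from (i , 1≤i , i< , x , ux , cx , sw) = swap-∈-neighbours i 1≤i i< ux cx sw

≤3*[m∸2]+1 : ∀ {c m} → 2 ≤ m → c + 5 ≤ 3 * m → c ≤ 3 * (m ∸ 2) + 1
≤3*[m∸2]+1 {m = suc zero} (s≤s ()) _
≤3*[m∸2]+1 {c} {suc (suc k)} _ c+5≤ = ℕ.+-cancelʳ-≤ 5 c _ (subst (c + 5 ≤_) (distrib k) c+5≤)
  where
  distrib : ∀ k → 3 * suc (suc k) ≡ 3 * k + 1 + 5
  distrib = solve-∀

lemma14 : (m : ℕ) (T : Tree) → size T ≡ m → 2 ≤ m →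
    Σ (List Tree) λ L → Unique L × (∀ S → (S ∈ L) ⇔ Ng T S) ×
      (m ∸ 1 ≤ length L × length L ≤ 3 * (m ∸ 2) + 1)
lemma14 _ (node L R) refl 2≤m =
  neighbours (node L R) , neighbours-unique (node L R) , ∈-neighbours⇔Ng (node L R) ,
  children-size≤count L R , ≤3*[m∸2]+1 2≤m (count+5≤3*size L R 2≤m)
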